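{- A $\mathsf{CacLL}$ formula cannot be both of the form $\widehat{A}$ and of the form $\widehat{B}^{\perp}$, for $\mathsf{acLL}$ formulae $A,B$.
   Context: The translation $\widehat{\cdot}$ from intuitionistic $\mathsf{acLL}$ formulae (connectives $\mathbin{\&},\oplus,\otimes,\to,\leftarrow,\top,!^i,\mathsf{1}$) to classical $\mathsf{CacLL}$ formulae is: $\widehat{p}=p$, $\widehat{A\otimes B}=\widehat{A}\otimes\widehat{B}$, $\widehat{A\to B}=\widehat{A}^{\perp}⅋\widehat{B}$, $\widehat{B\leftarrow A}=\widehat{B}⅋\widehat{A}^{\perp}$ (where $⅋$ is par), $\widehat{A\mathbin{\&}B}=\widehat{A}\mathbin{\&}\widehat{B}$, $\widehat{A\oplus B}=\widehat{A}\oplus\widehat{B}$, $\widehat{!^iA}=!^i\widehat{A}$, $\widehat{\mathsf{1}}=\mathsf{1}$, $\widehat{\top}=\top$; $F^\perp$ denotes the De Morgan dual of $F$ with negation pushed to atoms. -}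

module Defs where

open import Relation.Binary.PropositionalEquality using (_≡_)

-- Parameterised by a type of propositional atoms (At) and a type of
-- subexponential labels (Lab).
module Formulas (At : Set) (Lab : Set) where

  data IFm : Set where
    atom : At → IFm
    _&_  : IFm → IFm → IFm
    _⊕_  : IFm → IFm → IFm
    _⊗_  : IFm → IFm → IFm
    _⇒_  : IFm → IFm → IFm
    _⇐_  : IFm → IFm → IFm
    ⊤    : IFm
    ![_]_ : Lab → IFm → IFm
    𝟙    : IFm

  -- Classical CacLL formulae in negation normal form
  data CFm : Set where
    pos  : At → CFm
    neg  : At → CFm
    _⊗_  : CFm → CFm → CFm
    _⅋_  : CFm → CFm → CFm
    _&_  : CFm → CFm → CFm
    _⊕_  : CFm → CFm → CFm
    𝟙    : CFm
    bot  : CFm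
    ⊤    : CFm
    𝟘    : CFm
    ![_]_ : Lab → CFm → CFm
    ?[_]_ : Lab → CFm → CFm

  -- De Morgan dual, negation pushed to atoms (order of non-commutative
  -- connectives reversed: (A ⊗ B)^⊥ = B^⊥ ⅋ A^⊥, and dually)
  infix 30 _⊥
  _⊥ : CFm → CFm
  pos p ⊥ = neg p
  neg p ⊥ = pos p
  (F ⊗ G) ⊥ = (G ⊥) ⅋ (F ⊥)
  (F ⅋ G) ⊥ = (G ⊥) ⊗ (F ⊥)
  (F & G) ⊥ = (F ⊥) ⊕ (G ⊥)
  (F ⊕ G) ⊥ = (F ⊥) & (G ⊥)
  𝟙 ⊥ = bot
  bot ⊥ = 𝟙
  ⊤ ⊥ = 𝟘
  𝟘 ⊥ = ⊤
  (![ i ] F) ⊥ = ?[ i ] (F ⊥)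
  (?[ i ] F) ⊥ = ![ i ] (F ⊥)

  hat : IFm → CFm
  hat (atom p) = pos p
  hat (A ⊗ B) = hat A ⊗ hat B
  hat (A ⇒ B) = (hat A ⊥) ⅋ hat B
  hat (B ⇐ A) = hat B ⅋ (hat A ⊥)
  hat (A & B) = hat A & hat B
  hat (A ⊕ B) = hat A ⊕ hat B
  hat (![ i ] A) = ![ i ] hat A
  hat 𝟙 = 𝟙
  hat ⊤ = ⊤

{-# OPTIONS --safe #-}
module Submission where

-- Give every classical formula a polarity in Bool, read as a sign ±1 that is
-- multiplicative on ⊗ and anti-multiplicative on ⅋. Duality negates the
-- polarity, while every translated formula is positive: in  hat A ⊥ ⅋ hat B
-- the negative dual and the positive hat B multiply to a positive sign.
-- Hence no formula is both a translation and the dual of one.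

open import Data.Bool using (Bool; true; false; not; _xor_)
open import Data.Bool.Properties using (not-involutive; not-¬)
open import Relation.Binary.PropositionalEquality
  using (_≡_; refl; sym; trans; cong; cong₂)
open import Relation.Nullary using (¬_)
open import Defs

module Polarity (At Lab : Set) where
  open Formulas At Lab

  polarity : CFm → Bool
  polarity (pos p)     = true
  polarity (neg p)     = false
  polarity (F ⊗ G)     = not (polarity F xor polarity G)
  polarity (F ⅋ G)     = polarity F xor polarity G
  polarity (F & G)     = polarity F
  polarity (F ⊕ G)     = polarity F
  polarity 𝟙           = true
  polarity bot         = false
  polarity ⊤           = true
  polarity 𝟘           = false
  polarity (![ i ] F)  = polarity F
  polarity (?[ i ] F)  = polarity F

  not-xor-not : ∀ x y → not x xor not y ≡ y xor x
  not-xor-not true  true  = refl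
  not-xor-not true  false = refl
  not-xor-not false true  = refl
  not-xor-not false false = refl

  polarity-⊥ : ∀ F → polarity (F ⊥) ≡ not (polarity F)
  polarity-⊥ (pos p)    = refl
  polarity-⊥ (neg p)    = refl
  polarity-⊥ (F ⊗ G)    =
    trans (cong₂ _xor_ (polarity-⊥ G) (polarity-⊥ F))
          (trans (not-xor-not (polarity G) (polarity F)) (sym (not-involutive _)))
  polarity-⊥ (F ⅋ G)    =
    cong not (trans (cong₂ _xor_ (polarity-⊥ G) (polarity-⊥ F))
                    (not-xor-not (polarity G) (polarity F)))
  polarity-⊥ (F & G)    = polarity-⊥ F
  polarity-⊥ (F ⊕ G)    = polarity-⊥ F
  polarity-⊥ 𝟙          = refl
  polarity-⊥ bot        = refl
  polarity-⊥ ⊤          = refl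
  polarity-⊥ 𝟘          = refl
  polarity-⊥ (![ i ] F) = polarity-⊥ F
  polarity-⊥ (?[ i ] F) = polarity-⊥ F

  polarity-hat   : ∀ A → polarity (hat A) ≡ true
  polarity-hat-⊥ : ∀ A → polarity (hat A ⊥) ≡ false

  polarity-hat (atom p)   = refl
  polarity-hat (A & B)    = polarity-hat A
  polarity-hat (A ⊕ B)    = polarity-hat A
  polarity-hat (A ⊗ B)    = cong₂ (λ x y → not (x xor y)) (polarity-hat A) (polarity-hat B)
  polarity-hat (A ⇒ B)    = cong₂ _xor_ (polarity-hat-⊥ A) (polarity-hat B)
  polarity-hat (B ⇐ A)    = cong₂ _xor_ (polarity-hat B) (polarity-hat-⊥ A)
  polarity-hat ⊤          = refl
  polarity-hat (![ i ] A) = polarity-hat A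
  polarity-hat 𝟙          = refl

  polarity-hat-⊥ A = trans (polarity-⊥ (hat A)) (cong not (polarity-hat A))

corollary3p1 : (At Lab : Set) → (A B : Formulas.IFm At Lab) →
    ¬ (Formulas.hat At Lab A ≡ Formulas._⊥ At Lab (Formulas.hat At Lab B))
corollary3p1 At Lab A B hat≡dual =
  not-¬ (trans (polarity-hat A) (sym (polarity-hat B)))
        (trans (cong polarity hat≡dual) (polarity-⊥ (hat B)))
  where open Formulas At Lab
        open Polarity At Lab
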